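{- Let $\mathbf E=(E,+,{}',0,1)$ be an effect algebra. Then $E$ is a deductive system of $\mathbf E$. Moreover, a proper subset $D$ of $E$ containing $1$ is a deductive system of $\mathbf E$ if and only if $D\cap D'=\emptyset$.
   Context: An effect algebra is a partial algebra $(E,+,{}',0,1)$ of type $(2,1,0,0)$ where $+$ is a partial binary operation such that for all $x,y,z\in E$: (E1) $x+y$ is defined iff $y+x$ is defined, and then $x+y=y+x$; (E2) $(x+y)+z$ is defined iff $x+(y+z)$ is defined, and then they are equal; (E3) $x'$ is the unique $u\in E$ with $x+u=1$; (E4) if $1+x$ is defined then $x=0$. The induced order is $x\leq y$ iff $x+z=y$ for some $z$; $x+y$ is defined iff $x\leq y'$. $L(x,y)$ is the set of common lower bounds of $x,y$, and the implication is the subset $x\rightarrow y:=x'+L(x,y)=\{x'+u\mid u\in L(x,y)\}$. For $D\subseteq E$, $D'=\{d'\mid d\in D\}$. A subset $D\subseteq E$ is a deductive system of $\mathbf E$ if $1\in D$ and, for all $x,y\in E$, $x\in D$ and $x\rightarrow y\subseteq D$ imply $y\in D$. -}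

module Defs where

open import Level using (Level; suc; _⊔_)
open import Data.Product using (Σ; ∃; _×_; _,_)
open import Relation.Binary.PropositionalEquality using (_≡_)
open import Relation.Nullary using (¬_)

-- An effect algebra (E, +, ', 0, 1).  The partial operation + is encoded as its
-- graph:  Sum x y z  means "x + y is defined and x + y = z".
record EffectAlgebra (c : Level) : Set (suc c) where
  field
    Carrier : Set c
    Sum     : Carrier → Carrier → Carrier → Set c
    _′      : Carrier → Carrier
    𝟎 𝟏     : Carrier
    Sum-func : ∀ {x y z w} → Sum x y z → Sum x y w → z ≡ w
    E1 : ∀ {x y z} → Sum x y z → Sum y x z
    E2ˡ : ∀ {x y z u w} → Sum x y u → Sum u z w → Σ Carrier λ v → Sum y z v × Sum x v w
    E2ʳ : ∀ {x y z v w} → Sum y z v → Sum x v w → Σ Carrier λ u → Sum x y u × Sum u z w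
    E3-exists : ∀ x → Sum x (x ′) 𝟏
    E3-unique : ∀ {x u} → Sum x u 𝟏 → u ≡ x ′
    E4 : ∀ {x z} → Sum 𝟏 x z → x ≡ 𝟎
    𝟎-def : 𝟎 ≡ 𝟏 ′

  infix 4 _≤_
  _≤_ : Carrier → Carrier → Set c
  x ≤ y = Σ Carrier λ z → Sum x z y

  L : Carrier → Carrier → Carrier → Set c
  L x y u = u ≤ x × u ≤ y

  -- membership in the implication  x → y = x' + L(x,y)
  _⇒∋_ : Carrier × Carrier → Carrier → Set c
  (x , y) ⇒∋ w = Σ Carrier λ u → L x y u × Sum (x ′) u w

  Subset : (ℓ : Level) → Set (c ⊔ suc ℓ)
  Subset ℓ = Carrier → Set ℓ

  _ᶜ′ : ∀ {ℓ} → Subset ℓ → Subset (c ⊔ ℓ)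
  (D ᶜ′) e = Σ Carrier λ d → D d × e ≡ d ′

  ImplSubset : ∀ {ℓ} → Carrier → Carrier → Subset ℓ → Set (c ⊔ ℓ)
  ImplSubset x y D = ∀ w → (x , y) ⇒∋ w → D w

  IsDeductiveSystem : ∀ {ℓ} → Subset ℓ → Set (c ⊔ ℓ)
  IsDeductiveSystem D = D 𝟏 × (∀ x y → D x → ImplSubset x y D → D y)

  Proper : ∀ {ℓ} → Subset ℓ → Set (c ⊔ ℓ)
  Proper D = Σ Carrier λ x → ¬ D x

  DisjointFromComp : ∀ {ℓ} → Subset ℓ → Set (c ⊔ ℓ)
  DisjointFromComp D = ∀ e → D e → (D ᶜ′) e → ⊥′
    where open import Data.Empty using () renaming (⊥ to ⊥′)

-- Since 0 is a lower bound of any two elements, x' always lies in x → y; so if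
-- D ∩ D' = ∅, the premises x ∈ D and x → y ⊆ D are never met together and D is
-- trivially a deductive system.  Conversely, 0 is the only lower bound of 0, so
-- x → 0 = {x'} and 0 → y = {0'} = {1}.  A deductive system containing both d and
-- d' therefore contains 0 and then every y, which a proper subset cannot.
module Submission where

open import Defs
open import Level using (Level)
open import Data.Product using (_×_; _,_)
open import Data.Unit.Polymorphic using (⊤; tt)
open import Data.Empty using (⊥-elim)
open import Function.Bundles using (_⇔_; mk⇔)
open import Relation.Binary.PropositionalEquality
  using (_≡_; refl; sym; trans; subst; cong)

module EffectAlgebraProperties {c} (𝐄 : EffectAlgebra c) where
  open EffectAlgebra 𝐄

  ′-involutive : ∀ x → x ′ ′ ≡ x
  ′-involutive x = sym (E3-unique (E1 (E3-exists x)))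

  𝟎′≡𝟏 : 𝟎 ′ ≡ 𝟏
  𝟎′≡𝟏 = trans (cong _′ 𝟎-def) (′-involutive 𝟏)

  Sum-𝟏𝟎 : Sum 𝟏 𝟎 𝟏
  Sum-𝟏𝟎 = subst (λ t → Sum 𝟏 t 𝟏) (sym 𝟎-def) (E3-exists 𝟏)

  -- Reassociate x' + x = 1 with 1 + 0 = 1: x + 0 is then a complement of x'.
  Sum-identityʳ : ∀ x → Sum x 𝟎 x
  Sum-identityʳ x with E2ˡ (E3-exists (x ′)) Sum-𝟏𝟎
  ... | v , x′′+𝟎≡v , x′+v≡𝟏 =
    subst (λ t → Sum t 𝟎 t) (′-involutive x)
      (subst (Sum (x ′ ′) 𝟎) (E3-unique x′+v≡𝟏) x′′+𝟎≡v)

  Sum-identityʳ-unique : ∀ {x w} → Sum x 𝟎 w → w ≡ x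
  Sum-identityʳ-unique {x} s = Sum-func s (Sum-identityʳ x)

  𝟎≤ : ∀ x → 𝟎 ≤ x
  𝟎≤ x = x , E1 (Sum-identityʳ x)

  -- From u + z = 0 and 0 + 1 = 1 we get u + (z + 1) = 1, so z = 0 by (E4),
  -- hence z + 1 = 1, u + 1 = 1 and u = 0 by (E4) again.
  ≤𝟎⇒≡𝟎 : ∀ {u} → u ≤ 𝟎 → u ≡ 𝟎
  ≤𝟎⇒≡𝟎 {u} (z , u+z≡𝟎) with E2ˡ u+z≡𝟎 (E1 Sum-𝟏𝟎)
  ... | v , z+𝟏≡v , u+v≡𝟏 with E4 (E1 z+𝟏≡v)
  ... | refl = E4 (E1 (subst (λ t → Sum u t 𝟏) (Sum-func (E1 z+𝟏≡v) Sum-𝟏𝟎) u+v≡𝟏))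

  ⇒∋′ : ∀ x y → (x , y) ⇒∋ (x ′)
  ⇒∋′ x y = 𝟎 , (𝟎≤ x , 𝟎≤ y) , Sum-identityʳ (x ′)

  ⇒∋-unique : ∀ {x y w} → (∀ {u} → L x y u → u ≡ 𝟎) → (x , y) ⇒∋ w → w ≡ x ′
  ⇒∋-unique only𝟎 (u , Luxy , x′+u≡w) with only𝟎 Luxy
  ... | refl = Sum-identityʳ-unique x′+u≡w

  ⇒𝟎-unique : ∀ {x w} → (x , 𝟎) ⇒∋ w → w ≡ x ′
  ⇒𝟎-unique = ⇒∋-unique λ (_ , u≤𝟎) → ≤𝟎⇒≡𝟎 u≤𝟎

  𝟎⇒-unique : ∀ {y w} → (𝟎 , y) ⇒∋ w → w ≡ 𝟏
  𝟎⇒-unique m = trans (⇒∋-unique (λ (u≤𝟎 , _) → ≤𝟎⇒≡𝟎 u≤𝟎) m) 𝟎′≡𝟏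

module DeductiveSystems {c ℓ : Level} (𝐄 : EffectAlgebra c) where
  open EffectAlgebra 𝐄
  open EffectAlgebraProperties 𝐄

  full-isDeductiveSystem : IsDeductiveSystem {ℓ} (λ _ → ⊤)
  full-isDeductiveSystem = tt , λ _ _ _ _ → tt

  isDeductiveSystem-∩ᶜ′⇒full : ∀ {D : Subset ℓ} → IsDeductiveSystem D →
    ∀ {d} → D d → D (d ′) → ∀ y → D y
  isDeductiveSystem-∩ᶜ′⇒full {D} (D𝟏 , mp) {d} Dd Dd′ y =
    mp 𝟎 y D𝟎 λ w m → subst D (sym (𝟎⇒-unique m)) D𝟏
    where
    D𝟎 : D 𝟎
    D𝟎 = mp d 𝟎 Dd λ w m → subst D (sym (⇒𝟎-unique m)) Dd′

  isDeductiveSystem⇒disjoint : ∀ {D : Subset ℓ} → Proper D →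
    IsDeductiveSystem D → DisjointFromComp D
  isDeductiveSystem⇒disjoint (a , ¬Da) isDS e De (d , Dd , refl) =
    ¬Da (isDeductiveSystem-∩ᶜ′⇒full isDS Dd De a)

  disjoint⇒isDeductiveSystem : ∀ {D : Subset ℓ} → D 𝟏 →
    DisjointFromComp D → IsDeductiveSystem D
  disjoint⇒isDeductiveSystem D𝟏 disjoint =
    D𝟏 , λ x y Dx x⇒y⊆D → ⊥-elim (disjoint (x ′) (x⇒y⊆D (x ′) (⇒∋′ x y)) (x , Dx , refl))

theorem12 : ∀ {c ℓ} (𝐄 : EffectAlgebra c) → let open EffectAlgebra 𝐄 in
    IsDeductiveSystem {ℓ} (λ _ → ⊤)
    × (∀ (D : Subset ℓ) → Proper D → D 𝟏 → (IsDeductiveSystem D ⇔ DisjointFromComp D))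
theorem12 {c} {ℓ} 𝐄 =
  full-isDeductiveSystem ,
  λ D proper D𝟏 → mk⇔ (isDeductiveSystem⇒disjoint proper) (disjoint⇒isDeductiveSystem D𝟏)
  where open DeductiveSystems {c} {ℓ} 𝐄
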